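{- Let $p$ be an odd prime and $d\ge 2$. Let $M=\max\{h_p(\mathbf{a}):\mathbf{a}\in\mathbf{P}^{d-1}(\mathbf{F}_p)\}$. Then $M=\frac{dp}{2}$ if $d$ is even, and \[ \frac{(d-1)p}{2}+1\le M\le \frac{dp-1}{2} \] if $d$ is odd.
   Context: $\mathbf{F}_p=\mathbf{Z}/p\mathbf{Z}$. $\mathbf{P}^{d-1}(\mathbf{F}_p)$ is the set of equivalence classes $\langle a_1,\ldots,a_d\rangle$ of nonzero $d$-tuples in $\mathbf{F}_p^d$ under $(a_1,\ldots,a_d)\sim(ka_1,\ldots,ka_d)$ for $k\in\mathbf{F}_p^{\ast}$. For $x\in\mathbf{F}_p$, $x \bmod p$ denotes the least nonnegative integer in the class $x$. The height of $\mathbf{a}=\langle a_1,\ldots,a_d\rangle$ is $h_p(\mathbf{a})=\min\{\sum_{i=1}^d (ka_i \bmod p): k=1,\ldots,p-1\}$ (independent of the representative). -}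

module Defs where

open import Data.Nat using (ℕ; zero; suc; _+_; _*_; _≤_; _<_; _%_; _⊓_; NonZero)
import Data.Fin as Fin
open import Data.Nat.Primality using (Prime)
open import Data.Fin using (Fin; toℕ)
open import Data.List using (List; []; _∷_; map; foldr; upTo)
open import Data.Product using (Σ; ∃; _×_; _,_)
open import Data.Empty using (⊥)
open import Relation.Nullary using (¬_)
open import Relation.Binary.PropositionalEquality using (_≡_)

-- Elements of F_p are represented by Fin p; for x : Fin p, toℕ x is "x mod p",
-- the least nonnegative representative.  A d-tuple over F_p is a function Fin d → Fin p.

sumFin : (d : ℕ) → (Fin d → ℕ) → ℕ
sumFin zero    f = 0
sumFin (suc d) f = f Fin.zero + sumFin d (λ i → f (Fin.suc i))

Nonzero : {p d : ℕ} → (Fin d → Fin p) → Set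
Nonzero {p} {d} a = Σ (Fin d) λ i → ¬ (toℕ (a i) ≡ 0)

scaledRep : (p : ℕ) .{{_ : NonZero p}} → ℕ → Fin p → ℕ
scaledRep p k x = (k * toℕ x) % p

weight : (p d : ℕ) .{{_ : NonZero p}} → ℕ → (Fin d → Fin p) → ℕ
weight p d k a = sumFin d (λ i → scaledRep p k (a i))

minList : ℕ → List ℕ → ℕ
minList x xs = foldr _⊓_ x xs

-- h_p(a) = min { S_k(a) : k = 1, …, p-1 }.  For p = suc (suc q), the values
-- k = 1, …, q+1 = p-1 are 1 together with suc (suc j) for j < q.
height : (q d : ℕ) → (Fin d → Fin (suc (suc q))) → ℕ
height q d a = minList (weight (suc (suc q)) d 1 a)
                       (map (λ j → weight (suc (suc q)) d (suc (suc j)) a) (upTo q))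

-- M is the maximum of h_p over P^{d-1}(F_p).  Since h_p is independent of
-- the representative, this is the maximum of h_p over nonzero d-tuples.
IsMaxHeight : (q d : ℕ) → ℕ → Set
IsMaxHeight q d M =
  (Σ (Fin d → Fin (suc (suc q))) λ a → Nonzero a × height q d a ≡ M)
  × ((a : Fin d → Fin (suc (suc q))) → Nonzero a → height q d a ≤ M)

{-# OPTIONS --safe #-}
-- For x ≢ 0 the residues of x and of (p - 1)x = -x sum to p, while both vanish for
-- x = 0.  Hence S_1(a) + S_{p-1}(a) ≤ dp, so 2 h_p(a) ≤ dp, and 2 h_p(a) ≤ dp - 1 when
-- dp is odd.  Conversely, for the alternating tuple (1, -1, 1, -1, …) every S_k pairs
-- off into blocks of sum p, plus the residue k ≥ 1 of a final unpaired 1 when d is odd.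
module Submission where

open import Defs
open import Data.Nat using (ℕ; zero; suc; _+_; _*_; _∸_; _≤_; _<_; _⊓_; z≤n; s≤s; z<s)
open import Data.Nat.Properties
open import Data.Nat.DivMod using (_%_; [m+kn]%n≡m%n; m<n⇒m%n≡m)
open import Data.Nat.Divisibility using (_∣_; divides; ∣-refl; ∣m∣n⇒∣m+n; m∣m*n)
open import Data.Nat.Primality using (Prime; prime?; euclidsLemma)
open import Data.Nat.Tactic.RingSolver using (solve-∀)
open import Data.Fin using (Fin; toℕ; fromℕ)
open import Data.Fin.Properties using (toℕ<n; toℕ-fromℕ)
open import Data.List using (map; upTo)
open import Data.List.Properties using (foldr-preservesᵇ; foldr-preservesᵒ)
import Data.List.Relation.Unary.All.Properties as All
import Data.List.Relation.Unary.Any.Properties as Any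
open import Data.Product using (_×_; _,_)
open import Data.Sum using (_⊎_; inj₁; inj₂; [_,_]′)
open import Function using (_∘_)
open import Relation.Nullary using (¬_; contradiction)
open import Relation.Nullary.Decidable using (from-yes)
open import Relation.Binary.PropositionalEquality using (_≡_; refl; sym; trans; cong; cong₂; subst)
open import Algebra.Properties.CommutativeSemigroup +-commutativeSemigroup using (interchange)

open ≤-Reasoning

parity : ∀ n → 2 ∣ n ⊎ 2 ∣ suc n
parity zero    = inj₁ (divides 0 refl)
parity (suc n) = [ inj₂ ∘ ∣m∣n⇒∣m+n ∣-refl , inj₁ ]′ (parity n)

2*m≤n∧2∤n⇒2*m≤n∸1 : ∀ {m n} → ¬ 2 ∣ n → 2 * m ≤ n → 2 * m ≤ n ∸ 1
2*m≤n∧2∤n⇒2*m≤n∸1 {m} 2∤n 2m≤n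
  with ≤∧≢⇒< 2m≤n (λ 2m≡n → 2∤n (subst (2 ∣_) 2m≡n (m∣m*n m)))
... | s≤s 2m≤n-1 = 2m≤n-1

m*2*n≡2*[m*n] : ∀ m n → m * 2 * n ≡ 2 * (m * n)
m*2*n≡2*[m*n] m n = trans (cong (_* n) (*-comm m 2)) (*-assoc 2 m n)

m≤o⊎n≤o⇒m⊓n≤o : ∀ {o} m n → m ≤ o ⊎ n ≤ o → m ⊓ n ≤ o
m≤o⊎n≤o⇒m⊓n≤o m n = [ m≤n⇒m⊓o≤n n , m≤n⇒o⊓m≤n m ]′

-- n ≡ -1 modulo 1 + n.
suc[m]+[n*suc[m]]%suc[n]≡suc[n] : ∀ {m n} → m < n → suc m + (n * suc m) % suc n ≡ suc n
suc[m]+[n*suc[m]]%suc[n]≡suc[n] {m} (s≤s m≤n) with m≤n⇒∃[o]m+o≡n m≤n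
... | r , refl = begin-equality
  suc m + ((suc m + r) * suc m) % p   ≡⟨ cong (λ t → suc m + t % p) (expand m r) ⟩
  suc m + (suc r + m * p) % p         ≡⟨ cong (suc m +_) ([m+kn]%n≡m%n (suc r) m p) ⟩
  suc m + suc r % p                   ≡⟨ cong (suc m +_) (m<n⇒m%n≡m (s≤s (s≤s (m≤n+m r m)))) ⟩
  suc m + suc r                       ≡⟨ cong suc (+-suc m r) ⟩
  p                                   ∎
  where
  p = suc (suc m + r)
  expand : ∀ m r → (suc m + r) * suc m ≡ suc r + m * suc (suc m + r)
  expand = solve-∀

sumFin-+ : ∀ d (f g : Fin d → ℕ) → sumFin d f + sumFin d g ≡ sumFin d (λ i → f i + g i)
sumFin-+ zero    f g = refl
sumFin-+ (suc d) f g = begin-equality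
  (f zero + sumFin d (f ∘ suc)) + (g zero + sumFin d (g ∘ suc))
    ≡⟨ interchange (f zero) _ (g zero) _ ⟩
  (f zero + g zero) + (sumFin d (f ∘ suc) + sumFin d (g ∘ suc))
    ≡⟨ cong (f zero + g zero +_) (sumFin-+ d (f ∘ suc) (g ∘ suc)) ⟩
  (f zero + g zero) + sumFin d (λ i → f (suc i) + g (suc i))
    ∎
  where open Fin

sumFin-≤-* : ∀ d {f : Fin d → ℕ} c → (∀ i → f i ≤ c) → sumFin d f ≤ d * c
sumFin-≤-* zero    c f≤c = z≤n
sumFin-≤-* (suc d) c f≤c = +-mono-≤ (f≤c Fin.zero) (sumFin-≤-* d c (f≤c ∘ Fin.suc))

alternate : {A : Set} → A → A → {d : ℕ} → Fin d → A
alternate x y Fin.zero    = x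
alternate x y (Fin.suc i) = alternate y x i

sumFin-alternate : ∀ {A : Set} (g : A → ℕ) x y n → sumFin (n * 2) (g ∘ alternate x y) ≡ n * (g x + g y)
sumFin-alternate g x y zero    = refl
sumFin-alternate g x y (suc n) = begin-equality
  g x + (g y + sumFin (n * 2) (g ∘ alternate x y))  ≡⟨ +-assoc (g x) _ _ ⟨
  (g x + g y) + sumFin (n * 2) (g ∘ alternate x y)  ≡⟨ cong (g x + g y +_) (sumFin-alternate g x y n) ⟩
  (g x + g y) + n * (g x + g y)                     ∎

scaledRep-1+scaledRep-n≤suc[n] : ∀ n (x : Fin (suc n)) → scaledRep (suc n) 1 x + scaledRep (suc n) n x ≤ suc n
scaledRep-1+scaledRep-n≤suc[n] n x with toℕ x | toℕ<n x
... | zero  | _ rewrite *-zeroʳ n = z≤n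
... | suc m | 1+m<1+n@(s≤s m<n) = begin
  (1 * suc m) % suc n + (n * suc m) % suc n
    ≡⟨ cong (λ t → t % suc n + (n * suc m) % suc n) (*-identityˡ (suc m)) ⟩
  suc m % suc n + (n * suc m) % suc n
    ≡⟨ cong (_+ (n * suc m) % suc n) (m<n⇒m%n≡m 1+m<1+n) ⟩
  suc m + (n * suc m) % suc n
    ≡⟨ suc[m]+[n*suc[m]]%suc[n]≡suc[n] m<n ⟩
  suc n
    ∎

module _ {q : ℕ} where

  private
    p = suc (suc q)

  1ₚ -1ₚ : Fin p
  1ₚ  = Fin.suc Fin.zero
  -1ₚ = fromℕ (suc q)

  scaledRep-1ₚ : ∀ {j} → j ≤ q → scaledRep p (suc j) 1ₚ ≡ suc j
  scaledRep-1ₚ {j} j≤q = begin-equality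
    (suc j * 1) % p  ≡⟨ cong (_% p) (*-identityʳ (suc j)) ⟩
    suc j % p        ≡⟨ m<n⇒m%n≡m (s≤s (s≤s j≤q)) ⟩
    suc j            ∎

  scaledRep[1ₚ]+scaledRep[-1ₚ]≡p : ∀ {j} → j ≤ q → scaledRep p (suc j) 1ₚ + scaledRep p (suc j) -1ₚ ≡ p
  scaledRep[1ₚ]+scaledRep[-1ₚ]≡p {j} j≤q = begin-equality
    scaledRep p (suc j) 1ₚ + (suc j * toℕ -1ₚ) % p  ≡⟨ cong₂ (λ a b → a + b % p) (scaledRep-1ₚ j≤q) -1ₚ-scaled ⟩
    suc j + (suc q * suc j) % p                     ≡⟨ suc[m]+[n*suc[m]]%suc[n]≡suc[n] (s≤s j≤q) ⟩
    p                                               ∎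
    where
    -1ₚ-scaled : suc j * toℕ -1ₚ ≡ suc q * suc j
    -1ₚ-scaled = begin-equality
      suc j * toℕ -1ₚ  ≡⟨ cong (suc j *_) (toℕ-fromℕ (suc q)) ⟩
      suc j * suc q    ≡⟨ *-comm (suc j) (suc q) ⟩
      suc q * suc j    ∎

  height≤weight : ∀ {d} (a : Fin d → Fin p) {j} → j ≤ q → height q d a ≤ weight p d (suc j) a
  height≤weight a {zero}  _   = foldr-preservesᵒ m≤o⊎n≤o⇒m⊓n≤o _ (map _ (upTo q)) (inj₁ ≤-refl)
  height≤weight a {suc i} i<q =
    foldr-preservesᵒ m≤o⊎n≤o⇒m⊓n≤o _ _ (inj₂ (Any.map⁺ (Any.applyUpTo⁺ _ ≤-refl i<q)))

  ≤height : ∀ {d} (a : Fin d → Fin p) {b} → (∀ {j} → j ≤ q → b ≤ weight p d (suc j) a) → b ≤ height q d a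
  ≤height a {b} b≤weight =
    foldr-preservesᵇ {P = b ≤_} ⊓-glb (b≤weight z≤n) (All.map⁺ (All.applyUpTo⁺₁ _ q b≤weight))

  2*height≤d*p : ∀ d (a : Fin d → Fin p) → 2 * height q d a ≤ d * p
  2*height≤d*p d a = begin
    2 * height q d a
      ≡⟨ cong (height q d a +_) (+-identityʳ _) ⟩
    height q d a + height q d a
      ≤⟨ +-mono-≤ (height≤weight a z≤n) (height≤weight a ≤-refl) ⟩
    weight p d 1 a + weight p d (suc q) a
      ≡⟨ sumFin-+ d _ _ ⟩
    sumFin d (λ i → scaledRep p 1 (a i) + scaledRep p (suc q) (a i))
      ≤⟨ sumFin-≤-* d p (scaledRep-1+scaledRep-n≤suc[n] (suc q) ∘ a) ⟩
    d * p
      ∎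

  alternating : ∀ {d} → Fin d → Fin p
  alternating = alternate 1ₚ -1ₚ

  weight-alternating-even : ∀ n {j} → j ≤ q → weight p (n * 2) (suc j) alternating ≡ n * p
  weight-alternating-even n {j} j≤q = begin-equality
    weight p (n * 2) (suc j) alternating                     ≡⟨ sumFin-alternate (scaledRep p (suc j)) 1ₚ -1ₚ n ⟩
    n * (scaledRep p (suc j) 1ₚ + scaledRep p (suc j) -1ₚ)  ≡⟨ cong (n *_) (scaledRep[1ₚ]+scaledRep[-1ₚ]≡p j≤q) ⟩
    n * p                                                    ∎

  weight-alternating-odd : ∀ n {j} → j ≤ q → weight p (suc (n * 2)) (suc j) alternating ≡ suc j + n * p
  weight-alternating-odd n {j} j≤q = begin-equality
    weight p (suc (n * 2)) (suc j) alternating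
      ≡⟨ cong (scaledRep p (suc j) 1ₚ +_) (sumFin-alternate (scaledRep p (suc j)) -1ₚ 1ₚ n) ⟩
    scaledRep p (suc j) 1ₚ + n * (scaledRep p (suc j) -1ₚ + scaledRep p (suc j) 1ₚ)
      ≡⟨ cong₂ (λ a b → a + n * b) (scaledRep-1ₚ j≤q)
               (trans (+-comm (scaledRep p (suc j) -1ₚ) _) (scaledRep[1ₚ]+scaledRep[-1ₚ]≡p j≤q)) ⟩
    suc j + n * p
      ∎

  n*p≤height-alternating : ∀ n → n * p ≤ height q (n * 2) alternating
  n*p≤height-alternating n = ≤height (alternating {n * 2}) (≤-reflexive ∘ sym ∘ weight-alternating-even n)

  suc[n*p]≤height-alternating : ∀ n → suc (n * p) ≤ height q (suc (n * 2)) alternating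
  suc[n*p]≤height-alternating n = ≤height (alternating {suc (n * 2)}) (λ {j} j≤q → begin
    suc (n * p)                                 ≤⟨ s≤s (m≤n+m (n * p) j) ⟩
    suc j + n * p                               ≡⟨ weight-alternating-odd n j≤q ⟨
    weight p (suc (n * 2)) (suc j) alternating  ∎)

  IsMaxHeight⇒2*M≤d*p : ∀ {d M} → IsMaxHeight q d M → 2 * M ≤ d * p
  IsMaxHeight⇒2*M≤d*p {d} ((a , _ , refl) , _) = 2*height≤d*p d a

  IsMaxHeight⇒height-alternating≤M : ∀ {d M} → IsMaxHeight q (suc d) M → height q (suc d) alternating ≤ M
  IsMaxHeight⇒height-alternating≤M (_ , maximal) = maximal alternating (Fin.zero , λ ())

  IsMaxHeight-even : ∀ {d M} → 0 < d → IsMaxHeight q d M → 2 ∣ d → 2 * M ≡ d * p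
  IsMaxHeight-even () _ (divides zero refl)
  IsMaxHeight-even {M = M} _ isMax (divides n@(suc _) refl) = ≤-antisym (IsMaxHeight⇒2*M≤d*p isMax) (begin
    n * 2 * p                             ≡⟨ m*2*n≡2*[m*n] n p ⟩
    2 * (n * p)                           ≤⟨ *-monoʳ-≤ 2 (n*p≤height-alternating n) ⟩
    2 * height q (n * 2) alternating      ≤⟨ *-monoʳ-≤ 2 (IsMaxHeight⇒height-alternating≤M isMax) ⟩
    2 * M                                 ∎)

  IsMaxHeight-odd : ∀ {d M} → ¬ 2 ∣ p → IsMaxHeight q d M → ¬ 2 ∣ d →
                    (d ∸ 1) * p + 2 ≤ 2 * M × 2 * M ≤ d * p ∸ 1
  IsMaxHeight-odd {zero} _ _ 2∤d = contradiction (divides 0 refl) 2∤d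
  IsMaxHeight-odd {suc e} {M} 2∤p isMax 2∤d with parity e
  ... | inj₂ 2∣d               = contradiction 2∣d 2∤d
  ... | inj₁ (divides n refl) = lower , upper
    where
    lower : n * 2 * p + 2 ≤ 2 * M
    lower = begin
      n * 2 * p + 2                          ≡⟨ cong (_+ 2) (m*2*n≡2*[m*n] n p) ⟩
      2 * (n * p) + 2                        ≡⟨ +-comm (2 * (n * p)) 2 ⟩
      2 + 2 * (n * p)                        ≡⟨ *-suc 2 (n * p) ⟨
      2 * suc (n * p)                        ≤⟨ *-monoʳ-≤ 2 (suc[n*p]≤height-alternating n) ⟩
      2 * height q (suc (n * 2)) alternating ≤⟨ *-monoʳ-≤ 2 (IsMaxHeight⇒height-alternating≤M isMax) ⟩
      2 * M                                  ∎
    upper : 2 * M ≤ suc (n * 2) * p ∸ 1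
    upper = 2*m≤n∧2∤n⇒2*m≤n∸1 {M} ([ 2∤d , 2∤p ]′ ∘ euclidsLemma (suc (n * 2)) p (from-yes (prime? 2)))
                                (IsMaxHeight⇒2*M≤d*p isMax)

lemma2 : (q d M : ℕ) → Prime (suc (suc q)) → ¬ (2 ∣ suc (suc q)) → 2 ≤ d →
    IsMaxHeight q d M →
    (2 ∣ d → 2 * M ≡ d * suc (suc q))
    × (¬ (2 ∣ d) → ((d ∸ 1) * suc (suc q) + 2 ≤ 2 * M) × (2 * M ≤ d * suc (suc q) ∸ 1))
lemma2 q d M _ 2∤p 2≤d isMax = IsMaxHeight-even (<-≤-trans z<s 2≤d) isMax , IsMaxHeight-odd 2∤p isMax
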